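{- Let $d,r_1,r_2$ be positive integers. Suppose we are given a $(d,r_1)$-edge-kernel $F\subseteq E$ of a graph $G=(V,E)$ and a distributed algorithm that computes an $r_2$-ruling edge set of any graph on $n$ nodes with maximum degree $\Delta$ in time $T(n,\Delta)$. Then an $(r_1+r_2)$-ruling edge set of $G$ can be computed in time $T(n,d)$ (namely by running the given algorithm on $G[F]$).
   Context: The distance $\mathrm{dist}_G(e,f)$ between two edges is their distance in the line graph of $G$. For $F\subseteq E$, $G[F]=(V,F)$. A $(d,r)$-edge-kernel of $G$ is a set $F\subseteq E$ such that $G[F]$ has maximum degree at most $d$ and for every $e\in E$ there is $f\in F$ with $\mathrm{dist}_G(e,f)\leq r$. A $\beta$-ruling edge set of a graph is a set $R$ of its edges such that no two distinct edges of $R$ share an endpoint and every edge is at distance at most $\beta$ from some edge of $R$. -}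

module Defs where

open import Data.Nat using (ℕ; zero; suc; _+_; _≤_)
open import Data.Fin using (Fin)
open import Data.Bool using (Bool; true; false; if_then_else_)
open import Data.List using (List; map; allFin)
open import Data.Nat.ListAction using (sum)
open import Data.Product using (Σ; ∃; ∃-syntax; _×_; _,_; proj₁; proj₂)
open import Data.Sum using (_⊎_)
open import Relation.Binary.PropositionalEquality using (_≡_)

-- The same type also represents edge subsets F ⊆ E
-- (the spanning subgraph G[F] = (V,F) is then F itself).
record Graph (n : ℕ) : Set where
  field
    adj    : Fin n → Fin n → Bool
    sym    : ∀ u v → adj u v ≡ adj v u
    irrefl : ∀ u → adj u u ≡ false
open Graph public

_⊆ᴱ_ : ∀ {n} → Graph n → Graph n → Set
F ⊆ᴱ G = ∀ u v → adj F u v ≡ true → adj G u v ≡ true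

deg : ∀ {n} → Graph n → Fin n → ℕ
deg {n} G u = sum (map (λ v → if adj G u v then 1 else 0) (allFin n))

MaxDeg≤ : ∀ {n} → Graph n → ℕ → Set
MaxDeg≤ G d = ∀ u → deg G u ≤ d

SameEdge : ∀ {n} → Fin n × Fin n → Fin n × Fin n → Set
SameEdge (u , v) (x , y) = (u ≡ x × v ≡ y) ⊎ (u ≡ y × v ≡ x)

Touch : ∀ {n} → Fin n × Fin n → Fin n × Fin n → Set
Touch (u , v) (x , y) = (u ≡ x ⊎ u ≡ y) ⊎ (v ≡ x ⊎ v ≡ y)

-- DistLe G k e f : dist_G(e,f) ≤ k, i.e. there is a walk of length ≤ k
-- from e to f in the line graph of G (all intermediate edges lie in G).
data DistLe {n} (G : Graph n) : ℕ → Fin n × Fin n → Fin n × Fin n → Set where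
  here : ∀ {k e f} → SameEdge e f → DistLe G k e f
  step : ∀ {k e f} (g : Fin n × Fin n) → adj G (proj₁ g) (proj₂ g) ≡ true →
         Touch e g → DistLe G k g f → DistLe G (suc k) e f

EdgeKernel : ∀ {n} → Graph n → ℕ → ℕ → Graph n → Set
EdgeKernel {n} G d r F =
  F ⊆ᴱ G × MaxDeg≤ F d ×
  (∀ u v → adj G u v ≡ true →
     ∃[ x ] ∃[ y ] (adj F x y ≡ true × DistLe G r (u , v) (x , y)))

RulingEdgeSet : ∀ {n} → Graph n → ℕ → Graph n → Set
RulingEdgeSet {n} H β R =
  R ⊆ᴱ H ×
  (∀ u v w → adj R u v ≡ true → adj R u w ≡ true → v ≡ w) ×
  (∀ u v → adj H u v ≡ true →
     ∃[ x ] ∃[ y ] (adj R x y ≡ true × DistLe H β (u , v) (x , y)))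

record RulingAlgorithm (r : ℕ) (T : ℕ → ℕ → ℕ) : Set where
  field
    run     : ∀ {n} (Δ : ℕ) (H : Graph n) → MaxDeg≤ H Δ → Graph n × ℕ
    correct : ∀ {n} (Δ : ℕ) (H : Graph n) (p : MaxDeg≤ H Δ) →
              RulingEdgeSet H r (proj₁ (run Δ H p))
    time    : ∀ {n} (Δ : ℕ) (H : Graph n) (p : MaxDeg≤ H Δ) →
              proj₂ (run Δ H p) ≤ T n Δ
open RulingAlgorithm public

-- A ruling edge set R of the kernel F is a ruling edge set of G: R ⊆ F ⊆ G,
-- R is a matching, and every edge of G reaches an edge of F within r₁ steps,
-- which in turn reaches an edge of R within r₂ steps of F, hence of G.
module Submission where

open import Defs
open import Data.Nat using (ℕ; _+_; _≤_; s≤s)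
open import Data.Nat.Properties using (m≤n+m)
open import Data.Bool using (true)
open import Data.Product using (_×_; _,_; proj₁; proj₂; ∃-syntax)
open import Data.Sum using (inj₁; inj₂)
open import Data.Fin using (Fin)
open import Relation.Binary.PropositionalEquality using (_≡_; refl)

module _ {n : ℕ} where

  ⊆ᴱ-trans : {F G H : Graph n} → F ⊆ᴱ G → G ⊆ᴱ H → F ⊆ᴱ H
  ⊆ᴱ-trans F⊆G G⊆H u v uv∈F = G⊆H u v (F⊆G u v uv∈F)

  SameEdge-trans : {e f g : Fin n × Fin n} → SameEdge e f → SameEdge f g → SameEdge e g
  SameEdge-trans (inj₁ (refl , refl)) f≈g                  = f≈g
  SameEdge-trans (inj₂ (refl , refl)) (inj₁ (refl , refl)) = inj₂ (refl , refl)
  SameEdge-trans (inj₂ (refl , refl)) (inj₂ (refl , refl)) = inj₁ (refl , refl)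

  Touch-respˡ-SameEdge : {e f g : Fin n × Fin n} → SameEdge e f → Touch f g → Touch e g
  Touch-respˡ-SameEdge (inj₁ (refl , refl)) f~g        = f~g
  Touch-respˡ-SameEdge (inj₂ (refl , refl)) (inj₁ v~g) = inj₂ v~g
  Touch-respˡ-SameEdge (inj₂ (refl , refl)) (inj₂ u~g) = inj₁ u~g

  DistLe-respˡ-SameEdge : {G : Graph n} {k : ℕ} {e f g : Fin n × Fin n} →
                          SameEdge e f → DistLe G k f g → DistLe G k e g
  DistLe-respˡ-SameEdge e≈f (here f≈g)         = here (SameEdge-trans e≈f f≈g)
  DistLe-respˡ-SameEdge e≈f (step h h∈G f~h p) = step h h∈G (Touch-respˡ-SameEdge e≈f f~h) p

  DistLe-mono : {G : Graph n} {k m : ℕ} {e f : Fin n × Fin n} →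
                k ≤ m → DistLe G k e f → DistLe G m e f
  DistLe-mono _         (here e≈f)         = here e≈f
  DistLe-mono (s≤s k≤m) (step g g∈G e~g p) = step g g∈G e~g (DistLe-mono k≤m p)

  DistLe-trans : {G : Graph n} {a b : ℕ} {e f g : Fin n × Fin n} →
                 DistLe G a e f → DistLe G b f g → DistLe G (a + b) e g
  DistLe-trans {a = a} (here e≈f) q = DistLe-mono (m≤n+m _ a) (DistLe-respˡ-SameEdge e≈f q)
  DistLe-trans (step h h∈G e~h p) q = step h h∈G e~h (DistLe-trans p q)

  DistLe-mono-⊆ᴱ : {F G : Graph n} {k : ℕ} {e f : Fin n × Fin n} →
                   F ⊆ᴱ G → DistLe F k e f → DistLe G k e f
  DistLe-mono-⊆ᴱ F⊆G (here e≈f)         = here e≈f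
  DistLe-mono-⊆ᴱ F⊆G (step g g∈F e~g p) = step g (F⊆G _ _ g∈F) e~g (DistLe-mono-⊆ᴱ F⊆G p)

  ruling-of-kernel : (G F R : Graph n) (d r₁ r₂ : ℕ) →
                     EdgeKernel G d r₁ F → RulingEdgeSet F r₂ R → RulingEdgeSet G (r₁ + r₂) R
  ruling-of-kernel G F R _ r₁ r₂ (F⊆G , _ , F-covers) (R⊆F , R-matching , R-covers) =
    ⊆ᴱ-trans {R} {F} {G} R⊆F F⊆G , R-matching , covers
    where
      covers : ∀ u v → adj G u v ≡ true →
               ∃[ x ] ∃[ y ] (adj R x y ≡ true × DistLe G (r₁ + r₂) (u , v) (x , y))
      covers u v uv∈G with F-covers u v uv∈G
      ... | x , y , xy∈F , uv→xy with R-covers x y xy∈F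
      ... | x′ , y′ , x′y′∈R , xy→x′y′ =
        x′ , y′ , x′y′∈R , DistLe-trans uv→xy (DistLe-mono-⊆ᴱ F⊆G xy→x′y′)

lemma12 : (d r₁ r₂ : ℕ) → 1 ≤ d → 1 ≤ r₁ → 1 ≤ r₂ →
          (T : ℕ → ℕ → ℕ) (A : RulingAlgorithm r₂ T) →
          (n : ℕ) (G F : Graph n) (K : EdgeKernel G d r₁ F) →
          RulingEdgeSet G (r₁ + r₂) (proj₁ (run A d F (proj₁ (proj₂ K))))
          × proj₂ (run A d F (proj₁ (proj₂ K))) ≤ T n d
lemma12 d r₁ r₂ _ _ _ T A n G F K@(_ , F-maxdeg , _) =
  ruling-of-kernel G F output d r₁ r₂ K (correct A d F F-maxdeg) ,
  time A d F F-maxdeg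
  where
    output : Graph n
    output = proj₁ (run A d F F-maxdeg)
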